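{- For any countably infinite algebraically closed group $K$, the isomorphism class $\{G\in\mathcal G:\ \overline G\cong K\}$ is dense in $\mathcal G$.
   Context: Let $\mathbb N=\{1,2,3,\dots\}$. Equip $\mathbb N^{\mathbb N\times\mathbb N}$ with the product of the discrete topologies. Let $\mathcal G$ be the subspace consisting of tables that are the multiplication table of a group on $\mathbb N$ with identity element $1$ (subspace topology). For $G\in\mathcal G$, $\overline G$ denotes the group on $\mathbb N$ with multiplication table $G$. A group $K$ is algebraically closed if every finite system of equations and inequations in finitely many variables with parameters from $K$ that has a solution in some group containing $K$ already has a solution in $K$. -}

module Defs where

open import Level using (0ℓ)
open import Data.Nat using (ℕ; _<_)
open import Data.Fin using (Fin)
open import Data.List using (List)
open import Data.List.Relation.Unary.All using (All)
open import Data.Product using (Σ; _×_; ∃; ∃-syntax)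
open import Relation.Nullary using (¬_)
open import Relation.Binary.PropositionalEquality using (_≡_)
open import Algebra.Bundles using (Group)
open import Algebra.Morphism.Structures using (module GroupMorphisms)

-- Multiplication tables on ℕ.
-- The paper uses ℕ = {1,2,3,...} with identity 1; we use ℕ = {0,1,2,...}
-- with identity 0 (shift n ↦ n ∸ 1, a homeomorphism of the table spaces).

Table : Set
Table = ℕ → ℕ → ℕ

record IsGroupTable (T : Table) : Set where
  field
    assoc    : ∀ a b c → T (T a b) c ≡ T a (T b c)
    identityˡ : ∀ a → T 0 a ≡ a
    identityʳ : ∀ a → T a 0 ≡ a
    inverse  : ∀ a → ∃[ b ] (T a b ≡ 0 × T b a ≡ 0)

_≅Tab_ : Table → Group 0ℓ 0ℓ → Set
T ≅Tab K = Σ (ℕ → Carrier) λ φ →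
    (∀ a b → φ (T a b) ≈ (φ a ∙ φ b))
  × (∀ a b → φ a ≈ φ b → a ≡ b)
  × (∀ k → ∃[ a ] (φ a ≈ k))
  where open Group K

CountablyInfinite : Group 0ℓ 0ℓ → Set
CountablyInfinite K = Σ (ℕ → Carrier) λ φ →
    (∀ a b → φ a ≈ φ b → a ≡ b)
  × (∀ k → ∃[ a ] (φ a ≈ k))
  where open Group K

data Word (A : Set) (n : ℕ) : Set where
  var   : Fin n → Word A n
  const : A → Word A n
  one   : Word A n
  _·_   : Word A n → Word A n → Word A n
  inv   : Word A n → Word A n

eval : {A : Set} {n : ℕ} (H : Group 0ℓ 0ℓ) →
       (A → Group.Carrier H) → (Fin n → Group.Carrier H) →
       Word A n → Group.Carrier H
eval H f s (var i)   = s i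
eval H f s (const a) = f a
eval H f s one       = Group.ε H
eval H f s (u · v)   = Group._∙_ H (eval H f s u) (eval H f s v)
eval H f s (inv u)   = Group._⁻¹ H (eval H f s u)

record System (A : Set) (n : ℕ) : Set where
  constructor system
  field
    equations   : List (Word A n × Word A n)
    inequations : List (Word A n × Word A n)

IsSolution : {A : Set} {n : ℕ} (H : Group 0ℓ 0ℓ) →
             (A → Group.Carrier H) → (Fin n → Group.Carrier H) →
             System A n → Set
IsSolution H f s (system eqs neqs) =
    All (λ p → eval H f s (Data.Product.proj₁ p) ≈ eval H f s (Data.Product.proj₂ p)) eqs
  × All (λ p → ¬ (eval H f s (Data.Product.proj₁ p) ≈ eval H f s (Data.Product.proj₂ p))) neqs
  where open Group H using (_≈_)

IsEmbedding : (K H : Group 0ℓ 0ℓ) → (Group.Carrier K → Group.Carrier H) → Set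
IsEmbedding K H f = GroupMorphisms.IsGroupMonomorphism (Group.rawGroup K) (Group.rawGroup H) f

AlgebraicallyClosed : Group 0ℓ 0ℓ → Set₁
AlgebraicallyClosed K =
  ∀ (n : ℕ) (S : System (Group.Carrier K) n) →
  (Σ (Group 0ℓ 0ℓ) λ H → Σ (Group.Carrier K → Group.Carrier H) λ f →
     IsEmbedding K H f × ∃[ s ] IsSolution H f s S) →
  ∃[ s ] IsSolution K (λ k → k) s S

-- Density of a class of group tables in 𝒢 (product of discrete topologies):
-- every basic open neighbourhood of every G ∈ 𝒢 meets the class. Basic
-- neighbourhoods are given by fixing finitely many entries; these are
-- refined by fixing all entries in [0,m)×[0,m).

DenseInGroupTables : (Table → Set) → Set
DenseInGroupTables P =
  ∀ (G : Table) → IsGroupTable G → ∀ (m : ℕ) →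
  ∃[ H ] (IsGroupTable H × (∀ i j → i < m → j < m → H i j ≡ G i j) × P H)

{-# OPTIONS --safe #-}
-- Given G and m, choose N so that 0, …, N − 1 contains the square [0,m)² and all
-- products G i j on it. These N elements are distinct and satisfy the relations
-- i · j = G i j in K × Ḡ, which contains K; by algebraic closure, K has distinct
-- elements y₀, …, y_{N−1} satisfying the same relations, and y₀ = ε. Extending the
-- finite injection n ↦ index of y_n to a permutation of ℕ re-enumerates K so that
-- n is sent to y_n for n < N; pulling K's multiplication back along this enumeration
-- gives a table isomorphic to K that agrees with G on [0,m)².
module Submission where

open import Defs
open import Level using (0ℓ)
open import Algebra.Bundles using (Group)
import Algebra.Construct.DirectProduct as DirectProduct
import Algebra.Properties.Group as GroupProperties
open import Data.Empty using (⊥-elim)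
import Data.Fin as Fin
open import Data.Fin using (Fin; zero; suc; toℕ; fromℕ<; inject≤)
open import Data.Fin.Properties using (suc-injective; toℕ-injective; toℕ-fromℕ<; toℕ-inject≤)
open import Data.List using (List; _∷_; map; filter; cartesianProduct; allFin)
open import Data.List.Membership.Propositional using (_∈_)
open import Data.List.Membership.Propositional.Properties using (∈-map⁺; ∈-filter⁺; ∈-cartesianProduct⁺; ∈-allFin)
open import Data.List.Relation.Unary.All as All using (All; _∷_)
open import Data.List.Relation.Unary.Any using (there)
open import Data.List.Relation.Unary.All.Properties using (map⁺; map⁻; all-filter)
open import Data.Nat as ℕ using (ℕ; _≤_; _<_; _⊔_; s≤s)
open import Data.Nat.Properties using (≤-trans; m≤m⊔n; m≤n⊔m; n≤1+n)
open import Data.Product using (Σ; _×_; _,_; proj₁; proj₂; ∃-syntax)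
open import Function using (_∘_)
open import Function.Bundles using (Inverse; _↔_; mk↔ₛ′; Injection)
open import Function.Definitions using (Injective)
open import Function.Construct.Composition using (_↔-∘_)
import Function.Construct.Composition as Composition
import Function.Construct.Symmetry as Symmetry
open import Function.Construct.Identity using (↔-id)
open import Function.Properties.Inverse using (Inverse⇒Injection)
open import Relation.Binary.Bundles using (Setoid)
open import Relation.Binary.Definitions using (DecidableEquality)
open import Relation.Binary.PropositionalEquality as ≡ using (_≡_; _≢_; refl)
open import Relation.Nullary using (Dec; yes; no; ¬?)

module _ {A : Set} (_≟_ : DecidableEquality A) where

  transpose : A → A → A → A
  transpose a b x with x ≟ a
  ... | yes _ = b
  ... | no _ with x ≟ b
  ...   | yes _ = a
  ...   | no _ = x

  transpose-left : ∀ a b → transpose a b a ≡ b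
  transpose-left a b with a ≟ a
  ... | yes _ = refl
  ... | no a≢a = ⊥-elim (a≢a refl)

  transpose-right : ∀ a b → transpose a b b ≡ a
  transpose-right a b with b ≟ a
  ... | yes b≡a = b≡a
  ... | no _ with b ≟ b
  ...   | yes _ = refl
  ...   | no b≢b = ⊥-elim (b≢b refl)

  transpose-fixed : ∀ {a b x} → x ≢ a → x ≢ b → transpose a b x ≡ x
  transpose-fixed {a} {b} {x} x≢a x≢b with x ≟ a
  ... | yes x≡a = ⊥-elim (x≢a x≡a)
  ... | no _ with x ≟ b
  ...   | yes x≡b = ⊥-elim (x≢b x≡b)
  ...   | no _ = refl

  transpose-involutive : ∀ a b x → transpose a b (transpose a b x) ≡ x
  transpose-involutive a b x with x ≟ a
  ... | yes refl = transpose-right x b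
  ... | no x≢a with x ≟ b
  ...   | yes refl = transpose-left a x
  ...   | no x≢b = transpose-fixed x≢a x≢b

  transposition : A → A → A ↔ A
  transposition a b =
    mk↔ₛ′ (transpose a b) (transpose a b) (transpose-involutive a b) (transpose-involutive a b)

  -- Induction on the domain: fix the images of the later points, then
  -- transpose the image of p zero with q zero.
  injection-extends-to-permutation : ∀ {n} (p q : Fin n → A) →
    Injective _≡_ _≡_ p → Injective _≡_ _≡_ q →
    Σ (A ↔ A) λ π → ∀ k → Inverse.to π (p k) ≡ q k
  injection-extends-to-permutation {0} p q _ _ = ↔-id A , λ ()
  injection-extends-to-permutation {ℕ.suc n} p q p-inj q-inj =
    transposition (q zero) (π.to (p zero)) ↔-∘ π , extends
    where
    rest = injection-extends-to-permutation (p ∘ suc) (q ∘ suc)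
             (suc-injective ∘ p-inj) (suc-injective ∘ q-inj)
    π = proj₁ rest
    module π = Injection (Inverse⇒Injection π)

    extends : ∀ k → transpose (q zero) (π.to (p zero)) (π.to (p k)) ≡ q k
    extends zero = transpose-right (q zero) (π.to (p zero))
    extends (suc k) = ≡.trans (≡.cong (transpose _ _) (proj₂ rest k))
      (transpose-fixed (λ e → zero≢suc (q-inj (≡.sym e)))
                       (λ e → zero≢suc (p-inj (π.injective (≡.trans (≡.sym e) (≡.sym (proj₂ rest k)))))))
      where
      zero≢suc : zero ≢ suc k
      zero≢suc ()

Enumeration : ∀ {c ℓ} → Setoid c ℓ → Set _
Enumeration S = Inverse (≡.setoid ℕ) S

module _ {c ℓ} (S : Setoid c ℓ) where
  open Setoid S

  reenumerate : ∀ {n} (φ : Enumeration S) (y : Fin n → Carrier) → Injective _≡_ _≈_ y →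
    Σ (Enumeration S) λ ψ → ∀ k → Inverse.to ψ (toℕ k) ≈ y k
  reenumerate φ y y-inj = Composition.inverse π φ , λ k →
    trans (φ.to-cong (proj₂ permutation k)) (φ.strictlyInverseˡ (y k))
    where
    module φ = Inverse φ
    index-injective : Injective _≡_ _≡_ (φ.from ∘ y)
    index-injective = y-inj ∘ Injection.injective (Inverse⇒Injection (Symmetry.inverse φ))
    permutation = injection-extends-to-permutation ℕ._≟_ toℕ (φ.from ∘ y) toℕ-injective index-injective
    π = proj₁ permutation

module _ (K : Group 0ℓ 0ℓ) where
  open Group K

  countablyInfinite⇒enumeration : CountablyInfinite K → Enumeration setoid
  countablyInfinite⇒enumeration (φ , φ-inj , φ-surj) = record
    { to        = φ
    ; from      = index
    ; to-cong   = reflexive ∘ ≡.cong φ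
    ; from-cong = λ {k} {k′} k≈k′ → φ-inj _ _ (trans (φ-index k) (trans k≈k′ (sym (φ-index k′))))
    ; inverse   = (λ { refl → φ-index _ }) , λ {n} {k} k≈φn → φ-inj _ _ (trans (φ-index k) k≈φn)
    }
    where
    index : Carrier → ℕ
    index k = proj₁ (φ-surj k)
    φ-index : ∀ k → φ (index k) ≈ k
    φ-index k = proj₂ (φ-surj k)

  module Transport (ψ : Enumeration setoid) (ψ0≈ε : Inverse.to ψ 0 ≈ ε) where
    open Inverse ψ using (to; from; from-cong; strictlyInverseˡ)
    module ψ = Injection (Inverse⇒Injection ψ)

    table : Table
    table a b = from (to a ∙ to b)

    table-homo : ∀ a b → to (table a b) ≈ to a ∙ to b
    table-homo a b = strictlyInverseˡ _

    table-≡ : ∀ {a b c} → to a ∙ to b ≈ to c → table a b ≡ c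
    table-≡ = Inverse.inverseʳ ψ

    table-isGroupTable : IsGroupTable table
    table-isGroupTable = record
      { assoc     = λ a b c → from-cong (begin
          to (table a b) ∙ to c   ≈⟨ ∙-congʳ (table-homo a b) ⟩
          (to a ∙ to b) ∙ to c    ≈⟨ assoc _ _ _ ⟩
          to a ∙ (to b ∙ to c)    ≈⟨ ∙-congˡ (table-homo b c) ⟨
          to a ∙ to (table b c)   ∎)
      ; identityˡ = λ a → table-≡ (trans (∙-congʳ ψ0≈ε) (identityˡ _))
      ; identityʳ = λ a → table-≡ (trans (∙-congˡ ψ0≈ε) (identityʳ _))
      ; inverse   = λ a → from (to a ⁻¹)
          , table-≡ (trans (∙-congˡ (strictlyInverseˡ _)) (trans (inverseʳ _) (sym ψ0≈ε)))
          , table-≡ (trans (∙-congʳ (strictlyInverseˡ _)) (trans (inverseˡ _) (sym ψ0≈ε)))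
      }
      where
      open import Relation.Binary.Reasoning.Setoid setoid

    table≅K : table ≅Tab K
    table≅K = to , table-homo , (λ _ _ → ψ.injective) , λ k → from k , strictlyInverseˡ k

distinct? : ∀ {n} (p : Fin n × Fin n) → Dec (proj₁ p ≢ proj₂ p)
distinct? (i , j) = ¬? (i Fin.≟ j)

distinctPairs : (n : ℕ) → List (Fin n × Fin n)
distinctPairs n = filter distinct? (cartesianProduct (allFin n) (allFin n))

∈-distinctPairs : ∀ {n} {i j : Fin n} → i ≢ j → (i , j) ∈ distinctPairs n
∈-distinctPairs {i = i} {j} = ∈-filter⁺ distinct? (∈-cartesianProduct⁺ (∈-allFin i) (∈-allFin j))

distinctPairs-distinct : ∀ n → All (λ p → proj₁ p ≢ proj₂ p) (distinctPairs n)
distinctPairs-distinct n = all-filter distinct? (cartesianProduct (allFin n) (allFin n))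

Triple : ℕ → Set
Triple n = Fin n × Fin n × Fin n

Realizes : ∀ {n} (H : Group 0ℓ 0ℓ) → (Fin n → Group.Carrier H) → Triple n → Set
Realizes H x (i , j , k) = x i ∙ x j ≈ x k
  where open Group H

module _ (K : Group 0ℓ 0ℓ) (K-closed : AlgebraicallyClosed K) where
  open Group K

  configuration : ∀ {n} → List (Triple n) → System Carrier n
  configuration {n} E = system (map productEquation E) (map distinctness (distinctPairs n))
    where
    productEquation : Triple n → Word Carrier n × Word Carrier n
    productEquation (i , j , k) = var i · var j , var k
    distinctness : Fin n × Fin n → Word Carrier n × Word Carrier n
    distinctness (i , j) = var i , var j

  realizedInExtension⇒realizedInK : (H : Group 0ℓ 0ℓ) (f : Carrier → Group.Carrier H) →
    IsEmbedding K H f → ∀ {n} (E : List (Triple n)) (x : Fin n → Group.Carrier H) →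
    Injective _≡_ (Group._≈_ H) x → All (Realizes H x) E →
    ∃[ y ] (Injective _≡_ _≈_ y × All (Realizes K y) E)
  realizedInExtension⇒realizedInK H f f-embedding {n} E x x-inj x-realizes =
    y , y-inj , map⁻ (proj₁ (proj₂ solution))
    where
    solution = K-closed n (configuration E)
      (H , f , f-embedding , x , map⁺ x-realizes ,
       map⁺ (All.map (λ i≢j → i≢j ∘ x-inj) (distinctPairs-distinct n)))
    y = proj₁ solution
    y-inj : Injective _≡_ _≈_ y
    y-inj {i} {j} yi≈yj with i Fin.≟ j
    ... | yes i≡j = i≡j
    ... | no i≢j = ⊥-elim (All.lookup (map⁻ (proj₂ (proj₂ solution)))
      (∈-distinctPairs i≢j) yi≈yj)

tableGroup : (G : Table) → IsGroupTable G → Group 0ℓ 0ℓ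
tableGroup G G-group = record
  { Carrier = ℕ ; _≈_ = _≡_ ; _∙_ = G ; ε = 0 ; _⁻¹ = λ a → proj₁ (inverse a)
  ; isGroup = record
    { isMonoid = record
      { isSemigroup = record
        { isMagma = record { isEquivalence = ≡.isEquivalence ; ∙-cong = ≡.cong₂ G }
        ; assoc = assoc }
      ; identity = identityˡ , identityʳ }
    ; inverse = (λ a → proj₂ (proj₂ (inverse a))) , (λ a → proj₁ (proj₂ (inverse a)))
    ; ⁻¹-cong = ≡.cong (λ a → proj₁ (inverse a)) } }
  where open IsGroupTable G-group

module _ (K L : Group 0ℓ 0ℓ) where
  private
    module K = Group K
    module L = Group L
    K×L = DirectProduct.group K L

  ×-inj₁-isEmbedding : IsEmbedding K K×L (λ k → k , L.ε)
  ×-inj₁-isEmbedding = record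
    { isGroupHomomorphism = record
      { isMonoidHomomorphism = record
        { isMagmaHomomorphism = record
          { isRelHomomorphism = record { cong = λ k≈k′ → k≈k′ , L.refl }
          ; homo = λ _ _ → K.refl , L.sym (L.identityˡ L.ε) }
        ; ε-homo = K.refl , L.refl }
      ; ⁻¹-homo = λ _ → K.refl , L.sym (GroupProperties.ε⁻¹≈ε L) }
    ; injective = proj₁ }

  ×-inj₂-injective : ∀ {n} {x : Fin n → L.Carrier} →
    Injective _≡_ L._≈_ x → Injective _≡_ (Group._≈_ K×L) (λ i → K.ε , x i)
  ×-inj₂-injective x-inj = x-inj ∘ proj₂

  ×-inj₂-realizes : ∀ {n} {x : Fin n → L.Carrier} {t : Triple n} →
    Realizes L x t → Realizes K×L (λ i → K.ε , x i) t
  ×-inj₂-realizes r = K.identityˡ K.ε , r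

finite-bounded : ∀ {n} (f : Fin n → ℕ) → ∃[ B ] (∀ i → f i ≤ B)
finite-bounded {0} f = 0 , λ ()
finite-bounded {ℕ.suc n} f = f zero ⊔ B , λ
  { zero → m≤m⊔n (f zero) B
  ; (suc i) → ≤-trans (bounded i) (m≤n⊔m (f zero) B) }
  where
  B = proj₁ (finite-bounded (f ∘ suc))
  bounded = proj₂ (finite-bounded (f ∘ suc))

module TableFragment (G : Table) (G-group : IsGroupTable G) (m : ℕ) where
  row : Fin m → Fin m → ℕ
  row a b = G (toℕ a) (toℕ b)

  bound : ℕ
  bound = proj₁ (finite-bounded (proj₁ ∘ finite-bounded ∘ row))

  product≤bound : ∀ (a b : Fin m) → G (toℕ a) (toℕ b) ≤ bound
  product≤bound a b = ≤-trans (proj₂ (finite-bounded (row a)) b)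
                              (proj₂ (finite-bounded (proj₁ ∘ finite-bounded ∘ row)) a)

  N : ℕ
  N = ℕ.suc (m ⊔ bound)

  m≤N : m ≤ N
  m≤N = ≤-trans (m≤m⊔n m bound) (n≤1+n _)

  product<N : ∀ (a b : Fin m) → G (toℕ a) (toℕ b) < N
  product<N a b = s≤s (≤-trans (product≤bound a b) (m≤n⊔m m bound))

  entry : Fin m × Fin m → Triple N
  entry (a , b) = inject≤ a m≤N , inject≤ b m≤N , fromℕ< (product<N a b)

  -- The triple 0 · 0 = 0 forces every realization of the fragment to send 0 to ε.
  fragment : List (Triple N)
  fragment = (zero , zero , zero) ∷ map entry (cartesianProduct (allFin m) (allFin m))

  ∈-fragment : ∀ a b → entry (a , b) ∈ fragment
  ∈-fragment a b = there (∈-map⁺ entry (∈-cartesianProduct⁺ (∈-allFin a) (∈-allFin b)))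

  fragment-realized : All (Realizes (tableGroup G G-group) toℕ) fragment
  fragment-realized = IsGroupTable.identityˡ G-group 0 ∷ map⁺ (All.universal entry-realized _)
    where
    entry-realized : ∀ p → Realizes (tableGroup G G-group) toℕ (entry p)
    entry-realized (a , b) = ≡.trans (≡.cong₂ G (toℕ-inject≤ a m≤N) (toℕ-inject≤ b m≤N))
                                     (≡.sym (toℕ-fromℕ< (product<N a b)))

  module Interpretation (K : Group 0ℓ 0ℓ)
    {y : Fin N → Group.Carrier K} (y-realized : All (Realizes K y) fragment)
    {ψ : ℕ → Group.Carrier K} (ψ≈y : ∀ k → Group._≈_ K (ψ (toℕ k)) (y k)) where
    open Group K

    ψ≈y-at : ∀ {i} (k : Fin N) → toℕ k ≡ i → ψ i ≈ y k
    ψ≈y-at k ≡.refl = ψ≈y k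

    0↦ε : ψ 0 ≈ ε
    0↦ε = trans (ψ≈y zero) (GroupProperties.identityˡ-unique K _ _ (All.head y-realized))

    homo-on-square : ∀ {i j} → i < m → j < m → ψ (G i j) ≈ ψ i ∙ ψ j
    homo-on-square {i} {j} i<m j<m = begin
      ψ (G i j)                              ≈⟨ ψ≈y-at (fromℕ< (product<N a b)) product-index ⟩
      y (fromℕ< (product<N a b))             ≈⟨ All.lookup y-realized (∈-fragment a b) ⟨
      y (inject≤ a m≤N) ∙ y (inject≤ b m≤N)  ≈⟨ ∙-cong (ψ≈y-at _ (index i<m)) (ψ≈y-at _ (index j<m)) ⟨
      ψ i ∙ ψ j                              ∎
      where
      open import Relation.Binary.Reasoning.Setoid setoid
      a = fromℕ< i<m
      b = fromℕ< j<m
      index : ∀ {i} (i<m : i < m) → toℕ (inject≤ (fromℕ< i<m) m≤N) ≡ i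
      index i<m = ≡.trans (toℕ-inject≤ _ m≤N) (toℕ-fromℕ< i<m)
      product-index : toℕ (fromℕ< (product<N a b)) ≡ G i j
      product-index = ≡.trans (toℕ-fromℕ< _) (≡.cong₂ G (toℕ-fromℕ< i<m) (toℕ-fromℕ< j<m))

mainTheorem11 : (K : Group 0ℓ 0ℓ) → CountablyInfinite K → AlgebraicallyClosed K →
    DenseInGroupTables (λ T → T ≅Tab K)
mainTheorem11 K countable closed G G-group m = table , table-isGroupTable , agrees , table≅K
  where
  open Group K
  open TableFragment G G-group m
  Ḡ = tableGroup G G-group
  realized = realizedInExtension⇒realizedInK K closed (DirectProduct.group K Ḡ) _
    (×-inj₁-isEmbedding K Ḡ) fragment _ (×-inj₂-injective K Ḡ toℕ-injective)
    (All.map (×-inj₂-realizes K Ḡ {x = toℕ}) fragment-realized)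
  reenumerated = reenumerate setoid (countablyInfinite⇒enumeration K countable)
    (proj₁ realized) (proj₁ (proj₂ realized))
  ψ = proj₁ reenumerated
  open Interpretation K (proj₂ (proj₂ realized)) {Inverse.to ψ} (proj₂ reenumerated)
  open Transport K ψ 0↦ε

  agrees : ∀ i j → i < m → j < m → table i j ≡ G i j
  agrees i j i<m j<m = table-≡ (sym (homo-on-square i<m j<m))
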